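{- Let $\Omega$ be a set and $CS,SS,MA,MS,MB,P,B,PA,PB,PS:\Omega\to\overline{\mathbb R}$ be such that for every $s\in\Omega$ the values $MA(s),MS(s),PA(s),PB(s),PS(s)$ are pairwise distinct. Then $$\mathrm{SH}(PA,PB,PS,PS)\cdot\mathrm{SH}(PB,PA,PS,PS)+\mathrm{PAND}(MS,MA)+\mathrm{HSP}(MA,MB)+\mathrm{HSP}\big(\mathrm{FDEP}(CS+SS,P),\mathrm{FDEP}(CS+SS,B)\big)$$ $$=CS+SS+MA\cdot(MS\lhd MA)+MA\cdot MB+P\cdot B+PA\cdot PB\cdot PS.$$
   Context: $\overline{\mathbb R}=[-\infty,+\infty]$. All operations are pointwise on functions $\Omega\to\overline{\mathbb R}$: $(X+Y)(s)=\min(X(s),Y(s))$, $(X\cdot Y)(s)=\max(X(s),Y(s))$ ($\cdot$ binds tighter than $+$; both are associative); $(X\lhd Y)(s)=X(s)$ if $X(s)<Y(s)$, else $+\infty$; $\mathrm{PAND}(X,Y)(s)=Y(s)$ if $X(s)\le Y(s)$, else $+\infty$; $\mathrm{HSP}(Y,X)=Y\cdot X$; $\mathrm{FDEP}(X,T)=X+T$; shared spare gate $\mathrm{SH}(X,Y,Z_a,Z_d)=X\cdot(Z_d\lhd X)+Z_a\cdot(X\lhd Z_a)+X\cdot(Y\lhd X)$. -}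

module Defs where

open import Level using (Level)
open import Relation.Binary.Core using (Rel)
open import Relation.Binary.Definitions using (Tri; tri<; tri≈; tri>)
open import Relation.Binary.Structures using (IsStrictTotalOrder)
open import Relation.Binary.PropositionalEquality using (_≡_; _≢_)
open import Data.Product using (_×_)

-- Extended reals are modelled abstractly by a carrier A with a strict
-- total order _<_ (equality = propositional equality) and a greatest
-- element ∞ playing the role of +∞.
module Gates {a ℓ o : Level} {A : Set a} {_<_ : Rel A ℓ}
             (sto : IsStrictTotalOrder _≡_ _<_) (∞ : A) (Ω : Set o) where

  open IsStrictTotalOrder sto using (compare)

  -- pointwise minimum (the paper's "+")
  min : A → A → A
  min x y with compare x y
  ... | tri< _ _ _ = x
  ... | tri≈ _ _ _ = x
  ... | tri> _ _ _ = y

  -- pointwise maximum (the paper's "·")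
  max : A → A → A
  max x y with compare x y
  ... | tri< _ _ _ = y
  ... | tri≈ _ _ _ = y
  ... | tri> _ _ _ = x

  lhd : A → A → A
  lhd x y with compare x y
  ... | tri< _ _ _ = x
  ... | tri≈ _ _ _ = ∞
  ... | tri> _ _ _ = ∞

  pand : A → A → A
  pand x y with compare x y
  ... | tri< _ _ _ = y
  ... | tri≈ _ _ _ = y
  ... | tri> _ _ _ = ∞

  Fn : Set _
  Fn = Ω → A

  infixl 6 _⊕_
  infixl 7 _⊙_
  infix 8 _◁_

  _⊕_ : Fn → Fn → Fn
  (X ⊕ Y) s = min (X s) (Y s)

  _⊙_ : Fn → Fn → Fn
  (X ⊙ Y) s = max (X s) (Y s)

  _◁_ : Fn → Fn → Fn
  (X ◁ Y) s = lhd (X s) (Y s)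

  PAND : Fn → Fn → Fn
  PAND X Y s = pand (X s) (Y s)

  HSP : Fn → Fn → Fn
  HSP Y X = Y ⊙ X

  FDEP : Fn → Fn → Fn
  FDEP X T = X ⊕ T

  SH : Fn → Fn → Fn → Fn → Fn
  SH X Y Za Zd = X ⊙ (Zd ◁ X) ⊕ Za ⊙ (X ◁ Za) ⊕ X ⊙ (Y ◁ X)

  Distinct5 : A → A → A → A → A → Set a
  Distinct5 a b c d e =
    (a ≢ b) × (a ≢ c) × (a ≢ d) × (a ≢ e) ×
    (b ≢ c) × (b ≢ d) × (b ≢ e) ×
    (c ≢ d) × (c ≢ e) × (d ≢ e)

module Submission where

-- All gates act pointwise, so the identity is an
-- identity between values of a strict total order with top element ∞.
-- There, min and max are the natural choice operators, so the library's
-- lattice laws (commutativity, associativity, distributivity of min over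
-- max, ∞ as unit of min) are available once we exhibit them as such.
-- Writing  x after z  for  x · (z ◁ x)  (= x when z fails strictly before
-- x, and ∞ otherwise), three gate-level facts do the real work:
--   * PAND(x, y) = y after x  when x ≠ y;
--   * (x after z) + (z after x) = x · z  when x ≠ z;
--   * for pairwise distinct a, b, p the two shared-spare gates satisfy
--     SH(a,b,p,p) · SH(b,a,p,p) = a · b · p.
-- The second reduces SH(a,b,p,p) to  (a · p) + (a after b),  which is a
-- when b < a and a · p when a < b; the third follows by comparing a, b.
-- The theorem is then obtained by rewriting the four summands of the
-- left-hand side with these facts and with distributivity (the HSP of the
-- two FDEPs), and reordering the resulting sum of six terms.

open import Defs
open import Level using (Level)
open import Data.Empty using (⊥-elim)
open import Data.Product using (_,_)
open import Data.Sum using (inj₁; inj₂)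
open import Data.Fin using (zero; suc)
open import Data.Vec using ([]; _∷_)
open import Relation.Binary.Core using (Rel)
open import Relation.Binary.Bundles using (StrictTotalOrder)
open import Relation.Binary.Structures using (IsStrictTotalOrder)
open import Relation.Binary.Definitions using (Maximum; Tri; tri<; tri≈; tri>)
open import Relation.Binary.PropositionalEquality
  using (_≡_; _≢_; ≢-sym; refl; sym; trans; cong; cong₂; module ≡-Reasoning)
open import Relation.Nullary using (¬_)
open import Algebra.Bundles using (CommutativeMonoid)
open import Algebra.Construct.NaturalChoice.Base using (MinOperator; MaxOperator)
import Algebra.Construct.NaturalChoice.MinMaxOp as MinMaxOp
import Algebra.Solver.CommutativeMonoid as CommutativeMonoidSolver
import Relation.Binary.Properties.StrictTotalOrder as StrictTotalOrderProperties

-- The value-level theory.  The operations of Defs live in the module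
-- Gates, which also takes the sample space Ω; we therefore carry Ω along
-- even though none of the facts below depends on it.
module GateValues {a ℓ o : Level} {A : Set a} {_<_ : Rel A ℓ}
    (sto : IsStrictTotalOrder _≡_ _<_) (∞ : A) (∞-top : ∀ x → ¬ (∞ < x))
    (Ω : Set o) where

  open Gates sto ∞ Ω using (min; max; lhd; pand)
  open IsStrictTotalOrder sto using (compare; irrefl; asym)

  strictTotalOrder : StrictTotalOrder a a ℓ
  strictTotalOrder = record { isStrictTotalOrder = sto }

  open StrictTotalOrderProperties strictTotalOrder using (_≤_; totalPreorder)

  ≤⇒≯ : ∀ {x y} → x ≤ y → ¬ (y < x)
  ≤⇒≯ (inj₁ x<y) = asym x<y
  ≤⇒≯ (inj₂ refl) = irrefl refl

  min-operator : MinOperator totalPreorder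
  min-operator = record { _⊓_ = min ; x≤y⇒x⊓y≈x = x≤y⇒min≡x ; x≥y⇒x⊓y≈y = y≤x⇒min≡y }
    where
    x≤y⇒min≡x : ∀ {x y} → x ≤ y → min x y ≡ x
    x≤y⇒min≡x {x} {y} x≤y with compare x y
    ... | tri< _ _ _ = refl
    ... | tri≈ _ _ _ = refl
    ... | tri> _ _ y<x = ⊥-elim (≤⇒≯ x≤y y<x)
    y≤x⇒min≡y : ∀ {x y} → y ≤ x → min x y ≡ y
    y≤x⇒min≡y {x} {y} y≤x with compare x y
    ... | tri< x<y _ _ = ⊥-elim (≤⇒≯ y≤x x<y)
    ... | tri≈ _ x≡y _ = x≡y
    ... | tri> _ _ _ = refl

  max-operator : MaxOperator totalPreorder
  max-operator = record { _⊔_ = max ; x≤y⇒x⊔y≈y = x≤y⇒max≡y ; x≥y⇒x⊔y≈x = y≤x⇒max≡x }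
    where
    x≤y⇒max≡y : ∀ {x y} → x ≤ y → max x y ≡ y
    x≤y⇒max≡y {x} {y} x≤y with compare x y
    ... | tri< _ _ _ = refl
    ... | tri≈ _ _ _ = refl
    ... | tri> _ _ y<x = ⊥-elim (≤⇒≯ x≤y y<x)
    y≤x⇒max≡x : ∀ {x y} → y ≤ x → max x y ≡ x
    y≤x⇒max≡x {x} {y} y≤x with compare x y
    ... | tri< x<y _ _ = ⊥-elim (≤⇒≯ y≤x x<y)
    ... | tri≈ _ x≡y _ = sym x≡y
    ... | tri> _ _ _ = refl

  open MinMaxOp min-operator max-operator public
    using (⊓-comm; ⊓-identityʳ; ⊓-isMonoid; ⊓-distribˡ-⊔; ⊔-comm; ⊔-assoc; x≤x⊔y)
  open MinOperator min-operator using (x≥y⇒x⊓y≈y)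
  open MaxOperator max-operator using (x≤y⇒x⊔y≈y; x≥y⇒x⊔y≈x)

  ∞-maximum : Maximum _≤_ ∞
  ∞-maximum x with compare x ∞
  ... | tri< x<∞ _ _ = inj₁ x<∞
  ... | tri≈ _ x≡∞ _ = inj₂ x≡∞
  ... | tri> _ _ ∞<x = ⊥-elim (∞-top x ∞<x)

  min-commutativeMonoid : CommutativeMonoid a a
  min-commutativeMonoid = record
    { isCommutativeMonoid = record { isMonoid = ⊓-isMonoid ∞-maximum ; comm = ⊓-comm } }

  lhd-< : ∀ {x y} → x < y → lhd x y ≡ x
  lhd-< {x} {y} x<y with compare x y
  ... | tri< _ _ _ = refl
  ... | tri≈ x≮y _ _ = ⊥-elim (x≮y x<y)
  ... | tri> x≮y _ _ = ⊥-elim (x≮y x<y)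

  lhd-≮ : ∀ {x y} → ¬ (x < y) → lhd x y ≡ ∞
  lhd-≮ {x} {y} x≮y with compare x y
  ... | tri< x<y _ _ = ⊥-elim (x≮y x<y)
  ... | tri≈ _ _ _ = refl
  ... | tri> _ _ _ = refl

  after : A → A → A
  after x z = max x (lhd z x)

  after-< : ∀ {x z} → z < x → after x z ≡ x
  after-< {x} z<x = trans (cong (max x) (lhd-< z<x)) (x≥y⇒x⊔y≈x (inj₁ z<x))

  after-≮ : ∀ {x z} → ¬ (z < x) → after x z ≡ ∞
  after-≮ {x} z≮x = trans (cong (max x) (lhd-≮ z≮x)) (x≤y⇒x⊔y≈y (∞-maximum x))

  pand-< : ∀ {x y} → x < y → pand x y ≡ y
  pand-< {x} {y} x<y with compare x y
  ... | tri< _ _ _ = refl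
  ... | tri≈ x≮y _ _ = ⊥-elim (x≮y x<y)
  ... | tri> x≮y _ _ = ⊥-elim (x≮y x<y)

  pand-> : ∀ {x y} → y < x → pand x y ≡ ∞
  pand-> {x} {y} y<x with compare x y
  ... | tri< _ _ y≮x = ⊥-elim (y≮x y<x)
  ... | tri≈ _ _ y≮x = ⊥-elim (y≮x y<x)
  ... | tri> _ _ _ = refl

  pand-after : ∀ {x y} → x ≢ y → pand x y ≡ after y x
  pand-after {x} {y} x≢y = by-cases (compare x y)
    where
    by-cases : Tri (x < y) (x ≡ y) (y < x) → pand x y ≡ after y x
    by-cases (tri< x<y _ _) = trans (pand-< x<y) (sym (after-< x<y))
    by-cases (tri≈ _ x≡y _) = ⊥-elim (x≢y x≡y)
    by-cases (tri> _ _ y<x) = trans (pand-> y<x) (sym (after-≮ (asym y<x)))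

  after-pair : ∀ {x z} → x ≢ z → min (after x z) (after z x) ≡ max x z
  after-pair {x} {z} x≢z = by-cases (compare x z)
    where
    open ≡-Reasoning
    by-cases : Tri (x < z) (x ≡ z) (z < x) → min (after x z) (after z x) ≡ max x z
    by-cases (tri< x<z _ _) = begin
      min (after x z) (after z x)  ≡⟨ cong₂ min (after-≮ (asym x<z)) (after-< x<z) ⟩
      min ∞ z                      ≡⟨ x≥y⇒x⊓y≈y (∞-maximum z) ⟩
      z                            ≡⟨ sym (x≤y⇒x⊔y≈y (inj₁ x<z)) ⟩
      max x z                      ∎
    by-cases (tri≈ _ x≡z _) = ⊥-elim (x≢z x≡z)
    by-cases (tri> _ _ z<x) = begin
      min (after x z) (after z x)  ≡⟨ cong₂ min (after-< z<x) (after-≮ (asym z<x)) ⟩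
      min x ∞                      ≡⟨ ⊓-identityʳ ∞-maximum x ⟩
      x                            ≡⟨ sym (x≥y⇒x⊔y≈x (inj₁ z<x)) ⟩
      max x z                      ∎

  -- The value of the shared spare gate SH(X, Y, Z, Z) at a point where
  -- X, Y, Z take the values x, y, z.
  sharedSpare : A → A → A → A
  sharedSpare x y z = min (min (after x z) (after z x)) (after x y)

  sharedSpare-> : ∀ {x y z} → y < x → x ≢ z → sharedSpare x y z ≡ x
  sharedSpare-> {x} {y} {z} y<x x≢z = begin
    sharedSpare x y z        ≡⟨ cong₂ min (after-pair x≢z) (after-< y<x) ⟩
    min (max x z) x          ≡⟨ x≥y⇒x⊓y≈y (x≤x⊔y x z) ⟩
    x                        ∎
    where open ≡-Reasoning

  sharedSpare-< : ∀ {x y z} → x < y → x ≢ z → sharedSpare x y z ≡ max x z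
  sharedSpare-< {x} {y} {z} x<y x≢z = begin
    sharedSpare x y z        ≡⟨ cong₂ min (after-pair x≢z) (after-≮ (asym x<y)) ⟩
    min (max x z) ∞          ≡⟨ ⊓-identityʳ ∞-maximum (max x z) ⟩
    max x z                  ∎
    where open ≡-Reasoning

  sharedSpare-both : ∀ {a b p} → a ≢ b → a ≢ p → b ≢ p →
                     max (sharedSpare a b p) (sharedSpare b a p) ≡ max (max a b) p
  sharedSpare-both {a} {b} {p} a≢b a≢p b≢p = by-cases (compare a b)
    where
    open ≡-Reasoning
    by-cases : Tri (a < b) (a ≡ b) (b < a) →
               max (sharedSpare a b p) (sharedSpare b a p) ≡ max (max a b) p
    by-cases (tri< a<b _ _) = begin
      max (sharedSpare a b p) (sharedSpare b a p)
        ≡⟨ cong₂ max (sharedSpare-< a<b a≢p) (sharedSpare-> a<b b≢p) ⟩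
      max (max a p) b  ≡⟨ ⊔-assoc a p b ⟩
      max a (max p b)  ≡⟨ cong (max a) (⊔-comm p b) ⟩
      max a (max b p)  ≡⟨ sym (⊔-assoc a b p) ⟩
      max (max a b) p  ∎
    by-cases (tri≈ _ a≡b _) = ⊥-elim (a≢b a≡b)
    by-cases (tri> _ _ b<a) = begin
      max (sharedSpare a b p) (sharedSpare b a p)
        ≡⟨ cong₂ max (sharedSpare-> b<a a≢p) (sharedSpare-< b<a b≢p) ⟩
      max a (max b p)  ≡⟨ sym (⊔-assoc a b p) ⟩
      max (max a b) p  ∎

  min-rearrange : ∀ t x y c z → min (min (min t x) y) (min c z) ≡ min (min (min (min c x) y) z) t
  min-rearrange t x y c z =
    prove 5 (((T ⊕ X) ⊕ Y) ⊕ (C ⊕ Z)) ((((C ⊕ X) ⊕ Y) ⊕ Z) ⊕ T) (t ∷ x ∷ y ∷ c ∷ z ∷ [])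
    where
    open CommutativeMonoidSolver min-commutativeMonoid
    T X Y C Z : Expr 5
    T = var zero
    X = var (suc zero)
    Y = var (suc (suc zero))
    C = var (suc (suc (suc zero)))
    Z = var (suc (suc (suc (suc zero))))

lemma14 : {a ℓ o : Level} {A : Set a} {_<_ : Rel A ℓ}
          (sto : IsStrictTotalOrder _≡_ _<_) (∞ : A) (∞-top : ∀ x → ¬ (∞ < x))
          (Ω : Set o) →
          let open Gates sto ∞ Ω in
          (CS SS MA MS MB P B PA PB PS : Ω → A) →
          (∀ s → Distinct5 (MA s) (MS s) (PA s) (PB s) (PS s)) →
          ∀ s →
          (SH PA PB PS PS ⊙ SH PB PA PS PS ⊕ PAND MS MA ⊕ HSP MA MB
             ⊕ HSP (FDEP (CS ⊕ SS) P) (FDEP (CS ⊕ SS) B)) s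
          ≡ (CS ⊕ SS ⊕ MA ⊙ (MS ◁ MA) ⊕ MA ⊙ MB ⊕ P ⊙ B ⊕ PA ⊙ PB ⊙ PS) s
lemma14 {A = A} sto ∞ ∞-top Ω CS SS MA MS MB P B PA PB PS distinct s
  with distinct s
... | ma≢ms , _ , _ , _ , _ , _ , _ , pa≢pb , pa≢ps , pb≢ps = begin
  min (min (min (max (sharedSpare (PA s) (PB s) (PS s)) (sharedSpare (PB s) (PA s) (PS s)))
                (pand (MS s) (MA s)))
           (max (MA s) (MB s)))
      (max (min cut (P s)) (min cut (B s)))
    ≡⟨ cong₂ (λ u v → min (min (min u v) (max (MA s) (MB s))) (max (min cut (P s)) (min cut (B s))))
             (sharedSpare-both pa≢pb pa≢ps pb≢ps) (pand-after (≢-sym ma≢ms)) ⟩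
  min (min (min spares (after (MA s) (MS s))) (max (MA s) (MB s)))
      (max (min cut (P s)) (min cut (B s)))
    ≡⟨ cong (min _) (sym (⊓-distribˡ-⊔ cut (P s) (B s))) ⟩
  min (min (min spares (after (MA s) (MS s))) (max (MA s) (MB s))) (min cut (max (P s) (B s)))
    ≡⟨ min-rearrange spares _ _ cut _ ⟩
  min (min (min (min cut (after (MA s) (MS s))) (max (MA s) (MB s))) (max (P s) (B s))) spares
    ∎
  where
  open Gates sto ∞ Ω using (min; max; pand)
  open GateValues sto ∞ ∞-top Ω
  open ≡-Reasoning
  cut : A
  cut = min (CS s) (SS s)
  spares : A
  spares = max (max (PA s) (PB s)) (PS s)
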